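{- Let $P_1$ and $P_2$ be LPODs. Then $P_1$ and $P_2$ are strongly equivalent under the most-preferred answer sets (for every LPOD $P$, $P_1\cup P$ and $P_2\cup P$ have the same most-preferred answer sets) if and only if they are strongly equivalent under all the answer sets (for every LPOD $P$, $P_1\cup P$ and $P_2\cup P$ have the same answer sets).
   Context: Let $\Sigma$ be a nonempty, countably infinite set of propositional atoms. Formulas are built from atoms using the binary connectives $\wedge$, $\vee$, $\leftarrow$, $\times$ and the unary connective $\mathit{not}$. Truth values are $V=\{F,F^*,T^*,T\}$ ordered $F<F^*<T^*<T$. An interpretation is a function $I:\Sigma\to V$, extended to formulas by: $I(\mathit{not}\,\phi)=T$ if $I(\phi)\le F^*$ and $F$ otherwise; $I(\phi\leftarrow\psi)=T$ if $I(\phi)\ge I(\psi)$ and $F$ otherwise; $I(\phi_1\wedge\phi_2)=\min\{I(\phi_1),I(\phi_2)\}$; $I(\phi_1\vee\phi_2)=\max\{I(\phi_1),I(\phi_2)\}$; $I(\phi_1\times\phi_2)=I(\phi_2)$ if $I(\phi_1)=F^*$ and $I(\phi_1)$ otherwise (these are associative; a comma in a rule body denotes $\wedge$). An LPOD is a finite set of rules $C_1\times\cdots\times C_n\leftarrow A_1,\ldots,A_m,\mathit{not}\,B_1,\ldots,\mathit{not}\,B_k$ with $n\ge1$, $m,k\ge0$ and all $C_i,A_j,B_l$ atoms. An interpretation $I$ is a model of an LPOD $P$ if every rule of $P$ evaluates to $T$ under $I$. Define the relation $\prec$ on truth values by $F\prec F^*$, $F\prec T^*$, $F\prec T$, $T^*\prec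 T$ (and no other pairs), with $v_1\preceq v_2$ iff $v_1\prec v_2$ or $v_1=v_2$. For interpretations $I_1,I_2$ of $P$, $I_1\preceq I_2$ iff $I_1(A)\preceq I_2(A)$ for all atoms $A$ in $P$, and $I_1\prec I_2$ iff $I_1\preceq I_2$ and $I_1\ne I_2$. An interpretation $I$ is solid if $I(A)\ne T^*$ for all atoms $A$ in $P$. An answer set of $P$ is a solid $\preceq$-minimal model of $P$. For answer sets $M_1,M_2$ of $P$, letting $M_i^*$ be the set of atoms with value $F^*$ in $M_i$, write $M_1\sqsubset M_2$ iff $M_1^*\subsetneq M_2^*$. A most-preferred answer set of $P$ is an answer set of $P$ that is minimal with respect to $\sqsubset$ among all answer sets of $P$. -}

module Defs where

open import Data.Nat using (ℕ; _≤_)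
open import Data.List using (List; []; _∷_; _++_; concatMap)
open import Data.List.Membership.Propositional using (_∈_)
open import Data.Product using (_×_; Σ; ∃; _,_)
open import Relation.Binary.PropositionalEquality using (_≡_; _≢_)
open import Relation.Nullary using (¬_)

Atom : Set
Atom = ℕ

data V : Set where
  F F* T* T : V

rank : V → ℕ
rank F  = 0
rank F* = 1
rank T* = 2
rank T  = 3

_≤V_ : V → V → Set
u ≤V v = rank u ≤ rank v

open import Data.Nat using (_≤?_)
open import Relation.Nullary using (yes; no)

minV : V → V → V
minV u v with rank u ≤? rank v
... | yes _ = u
... | no  _ = v

maxV : V → V → V
maxV u v with rank u ≤? rank v
... | yes _ = v
... | no  _ = u

data Formula : Set where
  atom   : Atom → Formula
  _∧ᶠ_   : Formula → Formula → Formula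
  _∨ᶠ_   : Formula → Formula → Formula
  _←ᶠ_   : Formula → Formula → Formula
  _×ᶠ_   : Formula → Formula → Formula
  notᶠ   : Formula → Formula

Interpretation : Set
Interpretation = Atom → V

⟦_⟧ : Formula → Interpretation → V
⟦ atom a ⟧ I = I a
⟦ φ ∧ᶠ ψ ⟧ I = minV (⟦ φ ⟧ I) (⟦ ψ ⟧ I)
⟦ φ ∨ᶠ ψ ⟧ I = maxV (⟦ φ ⟧ I) (⟦ ψ ⟧ I)
⟦ φ ←ᶠ ψ ⟧ I with rank (⟦ ψ ⟧ I) ≤? rank (⟦ φ ⟧ I)
... | yes _ = T
... | no  _ = F
⟦ φ ×ᶠ ψ ⟧ I with ⟦ φ ⟧ I
... | F* = ⟦ ψ ⟧ I
... | v  = v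
⟦ notᶠ φ ⟧ I with rank (⟦ φ ⟧ I) ≤? 1
... | yes _ = T
... | no  _ = F

-- A rule  C₁ × ⋯ × Cₙ ← A₁,…,Aₘ, not B₁,…,not Bₖ  with n ≥ 1
record Rule : Set where
  constructor rule
  field
    headFirst : Atom
    headRest  : List Atom
    posBody   : List Atom
    negBody   : List Atom
open Rule public

-- C₁ × (C₂ × (… × Cₙ))   (× is associative)
headFormula : Atom → List Atom → Formula
headFormula c []       = atom c
headFormula c (d ∷ ds) = atom c ×ᶠ headFormula d ds

bodyLits : List Atom → List Atom → List Formula
bodyLits [] bs       = negLits bs
  where
  negLits : List Atom → List Formula
  negLits []       = []
  negLits (b ∷ bs) = notᶠ (atom b) ∷ negLits bs
bodyLits (a ∷ as) bs = atom a ∷ bodyLits as bs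

conj : Formula → List Formula → Formula
conj φ []       = φ
conj φ (ψ ∷ ψs) = φ ∧ᶠ conj ψ ψs

ruleFormula : Rule → Formula
ruleFormula r with bodyLits (posBody r) (negBody r)
... | []       = headFormula (headFirst r) (headRest r)
... | (φ ∷ φs) = headFormula (headFirst r) (headRest r) ←ᶠ conj φ φs

LPOD : Set
LPOD = List Rule

ruleAtoms : Rule → List Atom
ruleAtoms r = headFirst r ∷ (headRest r ++ (posBody r ++ negBody r))

atomsOf : LPOD → List Atom
atomsOf P = concatMap ruleAtoms P

IsModel : LPOD → Interpretation → Set
IsModel P I = ∀ r → r ∈ P → ⟦ ruleFormula r ⟧ I ≡ T

data _≺V_ : V → V → Set where
  F≺F* : F ≺V F*
  F≺T* : F ≺V T*
  F≺T  : F ≺V T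
  T*≺T : T* ≺V T

_⪯V_ : V → V → Set
u ⪯V v = (u ≺V v) Data.Sum.⊎ (u ≡ v)
  where import Data.Sum

_⪯[_]_ : Interpretation → LPOD → Interpretation → Set
I₁ ⪯[ P ] I₂ = ∀ a → a ∈ atomsOf P → I₁ a ⪯V I₂ a

_≺[_]_ : Interpretation → LPOD → Interpretation → Set
I₁ ≺[ P ] I₂ = (I₁ ⪯[ P ] I₂) × (∃ λ a → a ∈ atomsOf P × I₁ a ≢ I₂ a)

Solid : LPOD → Interpretation → Set
Solid P I = ∀ a → a ∈ atomsOf P → I a ≢ T*

IsAnswerSet : LPOD → Interpretation → Set
IsAnswerSet P M =
  Solid P M × IsModel P M × (∀ J → IsModel P J → ¬ (J ≺[ P ] M))

-- M₁ ⊏ M₂ iff M₁* ⊊ M₂*  (F*-atoms, among the atoms of P)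
_⊏[_]_ : Interpretation → LPOD → Interpretation → Set
M₁ ⊏[ P ] M₂ =
  (∀ a → a ∈ atomsOf P → M₁ a ≡ F* → M₂ a ≡ F*) ×
  (∃ λ a → a ∈ atomsOf P × M₂ a ≡ F* × M₁ a ≢ F*)

IsMostPreferred : LPOD → Interpretation → Set
IsMostPreferred P M =
  IsAnswerSet P M × (∀ N → IsAnswerSet P N → ¬ (N ⊏[ P ] M))

StronglyEquivAS : LPOD → LPOD → Set
StronglyEquivAS P₁ P₂ =
  ∀ (P : LPOD) (M : Interpretation) →
    (IsAnswerSet (P₁ ++ P) M → IsAnswerSet (P₂ ++ P) M) ×
    (IsAnswerSet (P₂ ++ P) M → IsAnswerSet (P₁ ++ P) M)

StronglyEquivMP : LPOD → LPOD → Set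
StronglyEquivMP P₁ P₂ =
  ∀ (P : LPOD) (M : Interpretation) →
    (IsMostPreferred (P₁ ++ P) M → IsMostPreferred (P₂ ++ P) M) ×
    (IsMostPreferred (P₂ ++ P) M → IsMostPreferred (P₁ ++ P) M)

-- Answer sets ⇒ most preferred: if P₁ ∪ P and P₂ ∪ P have the same answer sets, then whenever they
-- have one they have the same atoms (an atom of one program missing from the other could be raised
-- to T* in an answer set of the other, destroying solidity), so ⊏ is the same relation on both sides.
--
-- Most preferred ⇒ answer sets: let M be an answer set of P₁ ∪ P. For each atom a with M(a) ≤ F* add
-- the rule a′ ← a, not a′ with a fresh atom a′; in every answer set N of the extended program it
-- forces N(a) ≤ N(a′) ≤ F*. If moreover N's F*-atoms are among those of M, then N ⪯ M on P₁ ∪ P, so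
-- N = M there by minimality, and N(a′) = F* whenever M(a) = F*. Hence extending M by M(a′) = M(a)
-- gives a most-preferred answer set; the hypothesis carries it to P₂ ∪ P plus the new rules, and
-- dropping those rules leaves M an answer set of P₂ ∪ P.

module Submission where

open import Defs
open import Data.Empty using (⊥-elim)
open import Data.List using (List; []; _∷_; _++_; map; filter)
open import Data.List.Extrema.Nat using (max; xs≤max)
open import Data.List.Membership.Propositional using (_∈_; find; lose)
open import Data.List.Membership.Propositional.Properties using (∈-++⁺ˡ; ∈-++⁺ʳ; ∈-++⁻; ∈-concatMap⁺; ∈-concatMap⁻; ∈-map⁺; ∈-map⁻; ∈-filter⁺; ∈-filter⁻)
open import Data.List.Properties using (++-assoc; concatMap-++)
open import Data.List.Relation.Binary.Subset.Propositional using (_⊆_)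
open import Data.List.Relation.Unary.All using (lookup)
open import Data.List.Relation.Unary.Any using (here; there)
open import Data.Nat using (ℕ; suc; _+_; _∸_; _<_; z≤n; s≤s; _≤?_; _<?_)
open import Data.Nat.Properties using (_≟_; ≤-refl; ≤-trans; ≤-antisym; m+n≮m; m+n∸m≡n)
open import Data.Product using (_×_; ∃; _,_; proj₁; proj₂; uncurry)
open import Data.Sum using (_⊎_; inj₁; inj₂)
open import Relation.Binary.Definitions using (DecidableEquality)
open import Relation.Binary.PropositionalEquality using (_≡_; _≢_; refl; sym; trans; cong; cong₂; subst; module ≡-Reasoning)
open import Relation.Nullary using (¬_; yes; no)
open import Relation.Nullary.Decidable using (map′)

open import Data.List.Membership.DecPropositional _≟_ using (_∈?_)

fromRank : ℕ → V
fromRank 0 = F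
fromRank 1 = F*
fromRank 2 = T*
fromRank _ = T

fromRank-rank : ∀ v → fromRank (rank v) ≡ v
fromRank-rank F  = refl
fromRank-rank F* = refl
fromRank-rank T* = refl
fromRank-rank T  = refl

rank-injective : ∀ {u v} → rank u ≡ rank v → u ≡ v
rank-injective {u} {v} eq =
  trans (sym (fromRank-rank u)) (trans (cong fromRank eq) (fromRank-rank v))

_≟V_ : DecidableEquality V
u ≟V v = map′ rank-injective (cong rank) (rank u ≟ rank v)

≤V-antisym : ∀ {u v} → u ≤V v → v ≤V u → u ≡ v
≤V-antisym u≤v v≤u = rank-injective (≤-antisym u≤v v≤u)

⪯V⇒≤V : ∀ {u v} → u ⪯V v → u ≤V v
⪯V⇒≤V (inj₁ F≺F*) = z≤n
⪯V⇒≤V (inj₁ F≺T*) = z≤n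
⪯V⇒≤V (inj₁ F≺T)  = z≤n
⪯V⇒≤V (inj₁ T*≺T) = s≤s (s≤s z≤n)
⪯V⇒≤V (inj₂ refl) = ≤-refl

≤F*⇒≢T* : ∀ {v} → v ≤V F* → v ≢ T*
≤F*⇒≢T* (s≤s ()) refl

solid-⪯V : ∀ {u v} → u ≢ T* → v ≢ T* → (u ≡ F* → v ≡ F*) → (v ≤V F* → u ≤V F*) → u ⪯V v
solid-⪯V {T*}      u≢T* _ _ _ = ⊥-elim (u≢T* refl)
solid-⪯V {v = T*} _ v≢T* _ _ = ⊥-elim (v≢T* refl)
solid-⪯V {F}  {F}  _ _ _ _ = inj₂ refl
solid-⪯V {F}  {F*} _ _ _ _ = inj₁ F≺F*
solid-⪯V {F}  {T}  _ _ _ _ = inj₁ F≺T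
solid-⪯V {F*}      _ _ h _ rewrite h refl = inj₂ refl
solid-⪯V {T}  {T}  _ _ _ _ = inj₂ refl
solid-⪯V {T}  {F}  _ _ _ g with g z≤n
... | s≤s ()
solid-⪯V {T}  {F*} _ _ _ g with g (s≤s z≤n)
... | s≤s ()

impV : V → V → V
impV u v with rank v ≤? rank u
... | yes _ = T
... | no  _ = F

prodV : V → V → V
prodV F  v = F
prodV F* v = v
prodV T* v = T*
prodV T  v = T

notV : V → V
notV u with rank u ≤? 1
... | yes _ = T
... | no  _ = F

⟦←ᶠ⟧ : ∀ φ ψ I → ⟦ φ ←ᶠ ψ ⟧ I ≡ impV (⟦ φ ⟧ I) (⟦ ψ ⟧ I)
⟦←ᶠ⟧ φ ψ I with rank (⟦ ψ ⟧ I) ≤? rank (⟦ φ ⟧ I)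
... | yes _ = refl
... | no  _ = refl

⟦×ᶠ⟧ : ∀ φ ψ I → ⟦ φ ×ᶠ ψ ⟧ I ≡ prodV (⟦ φ ⟧ I) (⟦ ψ ⟧ I)
⟦×ᶠ⟧ φ ψ I with ⟦ φ ⟧ I
... | F  = refl
... | F* = refl
... | T* = refl
... | T  = refl

⟦notᶠ⟧ : ∀ φ I → ⟦ notᶠ φ ⟧ I ≡ notV (⟦ φ ⟧ I)
⟦notᶠ⟧ φ I with rank (⟦ φ ⟧ I) ≤? 1
... | yes _ = refl
... | no  _ = refl

AtomsIn : (Atom → Set) → Formula → Set
AtomsIn S (atom a) = S a
AtomsIn S (φ ∧ᶠ ψ) = AtomsIn S φ × AtomsIn S ψ
AtomsIn S (φ ∨ᶠ ψ) = AtomsIn S φ × AtomsIn S ψ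
AtomsIn S (φ ←ᶠ ψ) = AtomsIn S φ × AtomsIn S ψ
AtomsIn S (φ ×ᶠ ψ) = AtomsIn S φ × AtomsIn S ψ
AtomsIn S (notᶠ φ) = AtomsIn S φ

AtomsIn-mono : ∀ {S S′ : Atom → Set} φ → (∀ {a} → S a → S′ a) → AtomsIn S φ → AtomsIn S′ φ
AtomsIn-mono (atom a) f s = f s
AtomsIn-mono (φ ∧ᶠ ψ) f (s , t) = AtomsIn-mono φ f s , AtomsIn-mono ψ f t
AtomsIn-mono (φ ∨ᶠ ψ) f (s , t) = AtomsIn-mono φ f s , AtomsIn-mono ψ f t
AtomsIn-mono (φ ←ᶠ ψ) f (s , t) = AtomsIn-mono φ f s , AtomsIn-mono ψ f t
AtomsIn-mono (φ ×ᶠ ψ) f (s , t) = AtomsIn-mono φ f s , AtomsIn-mono ψ f t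
AtomsIn-mono (notᶠ φ) f s = AtomsIn-mono φ f s

⟦⟧-cong : ∀ φ {I J} → AtomsIn (λ a → I a ≡ J a) φ → ⟦ φ ⟧ I ≡ ⟦ φ ⟧ J
⟦⟧-cong (atom a) eq = eq
⟦⟧-cong (φ ∧ᶠ ψ) (p , q) = cong₂ minV (⟦⟧-cong φ p) (⟦⟧-cong ψ q)
⟦⟧-cong (φ ∨ᶠ ψ) (p , q) = cong₂ maxV (⟦⟧-cong φ p) (⟦⟧-cong ψ q)
⟦⟧-cong (φ ←ᶠ ψ) {I} {J} (p , q) =
  trans (⟦←ᶠ⟧ φ ψ I) (trans (cong₂ impV (⟦⟧-cong φ p) (⟦⟧-cong ψ q)) (sym (⟦←ᶠ⟧ φ ψ J)))
⟦⟧-cong (φ ×ᶠ ψ) {I} {J} (p , q) =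
  trans (⟦×ᶠ⟧ φ ψ I) (trans (cong₂ prodV (⟦⟧-cong φ p) (⟦⟧-cong ψ q)) (sym (⟦×ᶠ⟧ φ ψ J)))
⟦⟧-cong (notᶠ φ) {I} {J} p =
  trans (⟦notᶠ⟧ φ I) (trans (cong notV (⟦⟧-cong φ p)) (sym (⟦notᶠ⟧ φ J)))

headFormula-atoms : ∀ c ds → AtomsIn (_∈ c ∷ ds) (headFormula c ds)
headFormula-atoms c []       = here refl
headFormula-atoms c (d ∷ ds) =
  here refl , AtomsIn-mono (headFormula d ds) there (headFormula-atoms d ds)

bodyLits-atoms : ∀ ps ns {φ} → φ ∈ bodyLits ps ns → AtomsIn (_∈ ps ++ ns) φ
bodyLits-atoms []       (n ∷ ns) (here refl) = here refl
bodyLits-atoms []       (n ∷ ns) {φ} (there φ∈) = AtomsIn-mono φ there (bodyLits-atoms [] ns φ∈)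
bodyLits-atoms (p ∷ ps) ns       (here refl) = here refl
bodyLits-atoms (p ∷ ps) ns {φ} (there φ∈) = AtomsIn-mono φ there (bodyLits-atoms ps ns φ∈)

conj-atoms : ∀ {S} φ φs → (∀ {ψ} → ψ ∈ φ ∷ φs → AtomsIn S ψ) → AtomsIn S (conj φ φs)
conj-atoms φ []       h = h (here refl)
conj-atoms φ (ψ ∷ ψs) h = h (here refl) , conj-atoms ψ ψs (λ ψ∈ → h (there ψ∈))

headFormula-ruleAtoms : ∀ r → AtomsIn (_∈ ruleAtoms r) (headFormula (headFirst r) (headRest r))
headFormula-ruleAtoms r = AtomsIn-mono (headFormula c cs) headAtom (headFormula-atoms c cs)
  where
  c : Atom
  c = headFirst r
  cs : List Atom
  cs = headRest r
  headAtom : ∀ {a} → a ∈ c ∷ cs → a ∈ ruleAtoms r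
  headAtom (here a≡)  = here a≡
  headAtom (there a∈) = there (∈-++⁺ˡ a∈)

bodyLits-ruleAtoms : ∀ r {φ} → φ ∈ bodyLits (posBody r) (negBody r) → AtomsIn (_∈ ruleAtoms r) φ
bodyLits-ruleAtoms r {φ} φ∈ =
  AtomsIn-mono φ (λ a∈ → there (∈-++⁺ʳ (headRest r) a∈)) (bodyLits-atoms (posBody r) (negBody r) φ∈)

ruleFormula-atoms : ∀ r → AtomsIn (_∈ ruleAtoms r) (ruleFormula r)
ruleFormula-atoms r with bodyLits (posBody r) (negBody r) in eq
... | []     = headFormula-ruleAtoms r
... | φ ∷ φs = headFormula-ruleAtoms r
             , conj-atoms φ φs (λ {ψ} ψ∈ → bodyLits-ruleAtoms r (subst (ψ ∈_) (sym eq) ψ∈))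

ruleFormula-cong : ∀ r {I J} → (∀ {a} → a ∈ ruleAtoms r → I a ≡ J a) →
  ⟦ ruleFormula r ⟧ I ≡ ⟦ ruleFormula r ⟧ J
ruleFormula-cong r agree =
  ⟦⟧-cong (ruleFormula r) (AtomsIn-mono (ruleFormula r) agree (ruleFormula-atoms r))

atomsOf-++ : ∀ Q R → atomsOf (Q ++ R) ≡ atomsOf Q ++ atomsOf R
atomsOf-++ = concatMap-++ ruleAtoms

∈-atomsOf⁺ : ∀ {Q r x} → r ∈ Q → x ∈ ruleAtoms r → x ∈ atomsOf Q
∈-atomsOf⁺ r∈Q x∈r = ∈-concatMap⁺ ruleAtoms (lose r∈Q x∈r)

∈-atomsOf⁻ : ∀ Q {x} → x ∈ atomsOf Q → ∃ λ r → r ∈ Q × x ∈ ruleAtoms r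
∈-atomsOf⁻ Q x∈Q = find (∈-concatMap⁻ ruleAtoms {xs = Q} x∈Q)

∈-atomsOf-++⁺ˡ : ∀ Q R {x} → x ∈ atomsOf Q → x ∈ atomsOf (Q ++ R)
∈-atomsOf-++⁺ˡ Q R {x} x∈ = subst (x ∈_) (sym (atomsOf-++ Q R)) (∈-++⁺ˡ x∈)

∈-atomsOf-++⁻ : ∀ Q R {x} → x ∈ atomsOf (Q ++ R) → x ∈ atomsOf Q ⊎ x ∈ atomsOf R
∈-atomsOf-++⁻ Q R {x} x∈ = ∈-++⁻ (atomsOf Q) (subst (x ∈_) (atomsOf-++ Q R) x∈)

_[_≔_] : Interpretation → Atom → V → Interpretation
(I [ a ≔ v ]) x with x ≟ a
... | yes _ = v
... | no  _ = I x

[≔]-updated : ∀ I a v → (I [ a ≔ v ]) a ≡ v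
[≔]-updated I a v with a ≟ a
... | yes _   = refl
... | no  a≢a = ⊥-elim (a≢a refl)

[≔]-other : ∀ I {a x} v → x ≢ a → (I [ a ≔ v ]) x ≡ I x
[≔]-other I {a} {x} v x≢a with x ≟ a
... | yes x≡a = ⊥-elim (x≢a x≡a)
... | no  _   = refl

IsModel-cong : ∀ Q {I J} → (∀ {x} → x ∈ atomsOf Q → I x ≡ J x) → IsModel Q I → IsModel Q J
IsModel-cong Q agree model r r∈Q =
  trans (sym (ruleFormula-cong r (λ x∈r → agree (∈-atomsOf⁺ r∈Q x∈r)))) (model r r∈Q)

IsModel-++⁻ˡ : ∀ Q R {I} → IsModel (Q ++ R) I → IsModel Q I
IsModel-++⁻ˡ Q R model r r∈Q = model r (∈-++⁺ˡ r∈Q)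

IsModel-++⁺ : ∀ Q R {I} → IsModel Q I → IsModel R I → IsModel (Q ++ R) I
IsModel-++⁺ Q R modelQ modelR r r∈ with ∈-++⁻ Q r∈
... | inj₁ r∈Q = modelQ r r∈Q
... | inj₂ r∈R = modelR r r∈R

IsAnswerSet-cong : ∀ Q {M M′} → (∀ {x} → x ∈ atomsOf Q → M x ≡ M′ x) →
  IsAnswerSet Q M → IsAnswerSet Q M′
IsAnswerSet-cong Q agree (solid , model , minimal) =
    (λ x x∈ → subst (_≢ T*) (agree x∈) (solid x x∈))
  , IsModel-cong Q agree model
  , λ J modelJ (J⪯M′ , x , x∈ , Jx≢M′x) → minimal J modelJ
      ( (λ y y∈ → subst (J y ⪯V_) (sym (agree y∈)) (J⪯M′ y y∈))
      , x , x∈ , λ eq → Jx≢M′x (trans eq (agree x∈)))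

below-answerSet-agrees : ∀ Q {M K} → IsAnswerSet Q M → IsModel Q K → K ⪯[ Q ] M →
  ∀ {x} → x ∈ atomsOf Q → K x ≡ M x
below-answerSet-agrees Q {M} {K} (_ , _ , minimal) modelK K⪯M {x} x∈ with K x ≟V M x
... | yes eq  = eq
... | no  neq = ⊥-elim (minimal K modelK (K⪯M , x , x∈ , neq))

-- Raising an atom outside Q₁ to T* keeps M an answer set of Q₁, but makes it non-solid for Q₂.
answerSet-atoms-⊆ : ∀ Q₁ Q₂ {M} → (∀ N → IsAnswerSet Q₁ N → IsAnswerSet Q₂ N) → IsAnswerSet Q₁ M →
  atomsOf Q₂ ⊆ atomsOf Q₁
answerSet-atoms-⊆ Q₁ Q₂ {M} to asM {a} a∈Q₂ with a ∈? atomsOf Q₁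
... | yes a∈Q₁ = a∈Q₁
... | no  a∉Q₁ = ⊥-elim (proj₁ (to (M [ a ≔ T* ]) raised) a a∈Q₂ ([≔]-updated M a T*))
  where
  raised : IsAnswerSet Q₁ (M [ a ≔ T* ])
  raised = IsAnswerSet-cong Q₁ (λ x∈ → sym ([≔]-other M {a} T* λ { refl → a∉Q₁ x∈ })) asM

⊏-resp-atoms : ∀ Q₁ Q₂ {N M} → atomsOf Q₁ ⊆ atomsOf Q₂ → atomsOf Q₂ ⊆ atomsOf Q₁ →
  N ⊏[ Q₂ ] M → N ⊏[ Q₁ ] M
⊏-resp-atoms Q₁ Q₂ Q₁⊆Q₂ Q₂⊆Q₁ (N*⊆M* , x , x∈ , Mx≡F* , Nx≢F*) =
  (λ a a∈ → N*⊆M* a (Q₁⊆Q₂ a∈)) , x , Q₂⊆Q₁ x∈ , Mx≡F* , Nx≢F*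

mostPreferred-transfer : ∀ Q₁ Q₂ {M} →
  (∀ N → IsAnswerSet Q₁ N → IsAnswerSet Q₂ N) → (∀ N → IsAnswerSet Q₂ N → IsAnswerSet Q₁ N) →
  IsMostPreferred Q₁ M → IsMostPreferred Q₂ M
mostPreferred-transfer Q₁ Q₂ to from (asM , preferred) =
  to _ asM , λ N asN N⊏M → preferred N (from N asN) (⊏-resp-atoms Q₁ Q₂ Q₁⊆Q₂ Q₂⊆Q₁ N⊏M)
  where
  Q₂⊆Q₁ : atomsOf Q₂ ⊆ atomsOf Q₁
  Q₂⊆Q₁ = answerSet-atoms-⊆ Q₁ Q₂ to asM
  Q₁⊆Q₂ : atomsOf Q₁ ⊆ atomsOf Q₂
  Q₁⊆Q₂ = answerSet-atoms-⊆ Q₂ Q₁ from (to _ asM)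

capRule : Atom → Atom → Rule
capRule c a = rule c [] (a ∷ []) (c ∷ [])

capV : V → V → V
capV u v = impV u (minV v (notV u))

⟦capRule⟧ : ∀ c a I → ⟦ ruleFormula (capRule c a) ⟧ I ≡ capV (I c) (I a)
⟦capRule⟧ c a I = trans (⟦←ᶠ⟧ (atom c) (atom a ∧ᶠ notᶠ (atom c)) I)
                        (cong (λ w → impV (I c) (minV (I a) w)) (⟦notᶠ⟧ (atom c) I))

capV-T* : ∀ v → capV T* v ≡ T
capV-T* F  = refl
capV-T* F* = refl
capV-T* T* = refl
capV-T* T  = refl

capV-refl : ∀ {v} → v ≤V F* → capV v v ≡ T
capV-refl {F}  _ = refl
capV-refl {F*} _ = refl
capV-refl {T*} (s≤s ())
capV-refl {T}  (s≤s ())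

capV-≤ : ∀ {u v} → u ≤V F* → capV u v ≡ T → v ≤V u
capV-≤ {F}  {F}  _ _ = z≤n
capV-≤ {F}  {F*} _ ()
capV-≤ {F}  {T*} _ ()
capV-≤ {F}  {T}  _ ()
capV-≤ {F*} {F}  _ _ = z≤n
capV-≤ {F*} {F*} _ _ = s≤s z≤n
capV-≤ {F*} {T*} _ ()
capV-≤ {F*} {T}  _ ()
capV-≤ {T*} (s≤s ()) _
capV-≤ {T}  (s≤s ()) _

capV-⪯ : ∀ {u v} → u ⪯V v → v ≤V F* → capV u v ≡ T → u ≡ v
capV-⪯ {u} {v} u⪯v v≤F* holds = ≤V-antisym u≤v (capV-≤ (≤-trans u≤v v≤F*) holds)
  where
  u≤v : u ≤V v
  u≤v = ⪯V⇒≤V u⪯v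

capRule-T* : ∀ {c a I} → I c ≡ T* → ⟦ ruleFormula (capRule c a) ⟧ I ≡ T
capRule-T* {c} {a} {I} Ic≡T* =
  trans (⟦capRule⟧ c a I) (subst (λ u → capV u (I a) ≡ T) (sym Ic≡T*) (capV-T* (I a)))

Fresh : Atom → LPOD → Set
Fresh c Q = ∀ {r} → r ∈ Q → c ∈ ruleAtoms r → ∃ λ a → r ≡ capRule c a

-- Minimality forbids N c = T: lowering c to T* keeps a model, as c ≥ T* satisfies c ← a′, not c.
capRule-bounds : ∀ Q {N c a} → IsAnswerSet Q N → capRule c a ∈ Q → Fresh c Q →
  N a ≤V N c × N c ≤V F*
capRule-bounds Q {N} {c} {a} (solid , model , minimal) cap∈Q fresh =
  capV-≤ Nc≤F* (trans (sym (⟦capRule⟧ c a N)) (model _ cap∈Q)) , Nc≤F*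
  where
  c∈Q : c ∈ atomsOf Q
  c∈Q = ∈-atomsOf⁺ cap∈Q (here refl)

  lowered : IsModel Q (N [ c ≔ T* ])
  lowered r r∈Q with c ∈? ruleAtoms r
  ... | no c∉r =
    trans (ruleFormula-cong r (λ x∈r → [≔]-other N T* λ { refl → c∉r x∈r })) (model r r∈Q)
  ... | yes c∈r with fresh r∈Q c∈r
  ...   | a′ , refl = capRule-T* ([≔]-updated N c T*)

  Nc≢T : N c ≢ T
  Nc≢T Nc≡T = minimal (N [ c ≔ T* ]) lowered (below , c , c∈Q , differs)
    where
    differs : (N [ c ≔ T* ]) c ≢ N c
    differs eq with trans (sym ([≔]-updated N c T*)) (trans eq Nc≡T)
    ... | ()
    below : (N [ c ≔ T* ]) ⪯[ Q ] N
    below x _ with x ≟ c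
    ... | yes refl = subst (T* ⪯V_) (sym Nc≡T) (inj₁ T*≺T)
    ... | no  _    = inj₂ refl

  Nc≤F* : N c ≤V F*
  Nc≤F* with N c in eq
  ... | F  = z≤n
  ... | F* = s≤s z≤n
  ... | T* = ⊥-elim (solid c c∈Q eq)
  ... | T  = ⊥-elim (Nc≢T eq)

capRule-atoms : ∀ {x c a} → x ∈ ruleAtoms (capRule c a) → x ≡ c ⊎ x ≡ a
capRule-atoms (here x≡c)                 = inj₁ x≡c
capRule-atoms (there (here x≡a))         = inj₂ x≡a
capRule-atoms (there (there (here x≡c))) = inj₁ x≡c

caps : Interpretation → ℕ → List Atom → LPOD
caps M b A = map (λ a → capRule (b + a) a) (filter (λ a → rank (M a) ≤? 1) A)

∈-caps⁻ : ∀ M b A {r} → r ∈ caps M b A → ∃ λ a → a ∈ A × M a ≤V F* × r ≡ capRule (b + a) a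
∈-caps⁻ M b A r∈ with ∈-map⁻ (λ a → capRule (b + a) a) r∈
... | a , a∈ , refl with ∈-filter⁻ (λ a → rank (M a) ≤? 1) a∈
...   | a∈A , Ma≤F* = a , a∈A , Ma≤F* , refl

∈-caps⁺ : ∀ M b {A a} → a ∈ A → M a ≤V F* → capRule (b + a) a ∈ caps M b A
∈-caps⁺ M b a∈A Ma≤F* =
  ∈-map⁺ (λ a → capRule (b + a) a) (∈-filter⁺ (λ a → rank (M a) ≤? 1) a∈A Ma≤F*)

unshift : ℕ → Atom → Atom
unshift b x with x <? b
... | yes _ = x
... | no  _ = x ∸ b

-- With b above every atom in use, I ↑ b treats b + a as a fresh copy of the atom a.
_↑_ : Interpretation → ℕ → Interpretation
(I ↑ b) x = I (unshift b x)

↑-below : ∀ I {b x} → x < b → (I ↑ b) x ≡ I x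
↑-below I {b} {x} x<b with x <? b
... | yes _   = refl
... | no  x≮b = ⊥-elim (x≮b x<b)

↑-shifted : ∀ I b a → (I ↑ b) (b + a) ≡ I a
↑-shifted I b a with b + a <? b
... | yes b+a<b = ⊥-elim (m+n≮m b a b+a<b)
... | no  _     = cong I (m+n∸m≡n b a)

overlay : List Atom → Interpretation → Interpretation → Interpretation
overlay A J M x with x ∈? A
... | yes _ = J x
... | no  _ = M x

overlay-∈ : ∀ A J M {x} → x ∈ A → overlay A J M x ≡ J x
overlay-∈ A J M {x} x∈A with x ∈? A
... | yes _   = refl
... | no  x∉A = ⊥-elim (x∉A x∈A)

overlay-⪯ : ∀ A J M → (∀ x → x ∈ A → J x ⪯V M x) → ∀ x → overlay A J M x ⪯V M x
overlay-⪯ A J M J⪯M x with x ∈? A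
... | yes x∈A = J⪯M x x∈A
... | no  _   = inj₂ refl

bound : List Atom → ℕ
bound L = suc (max 0 L)

<-bound : ∀ {L x} → x ∈ L → x < bound L
<-bound {L} x∈L = s≤s (lookup (xs≤max 0 L) x∈L)

module Capped (Q : LPOD) (M : Interpretation) (b : ℕ) (A : List Atom)
              (Q<b : ∀ {x} → x ∈ atomsOf Q → x < b) (A<b : ∀ {x} → x ∈ A → x < b) where

  R : LPOD
  R = caps M b A

  open ≡-Reasoning

  ∈-atoms⁻ : ∀ {x} → x ∈ atomsOf (Q ++ R) →
    x ∈ atomsOf Q ⊎ ∃ λ a → a ∈ A × M a ≤V F* × (x ≡ b + a ⊎ x ≡ a)
  ∈-atoms⁻ x∈ with ∈-atomsOf-++⁻ Q R x∈
  ... | inj₁ x∈Q = inj₁ x∈Q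
  ... | inj₂ x∈R with ∈-atomsOf⁻ R x∈R
  ...   | r , r∈R , x∈r with ∈-caps⁻ M b A r∈R
  ...     | a , a∈A , Ma≤F* , refl = inj₂ (a , a∈A , Ma≤F* , capRule-atoms x∈r)

  capHead-fresh : ∀ a → Fresh (b + a) (Q ++ R)
  capHead-fresh a r∈ c∈r with ∈-++⁻ Q r∈
  ... | inj₁ r∈Q = ⊥-elim (m+n≮m b a (Q<b (∈-atomsOf⁺ r∈Q c∈r)))
  ... | inj₂ r∈R with ∈-caps⁻ M b A r∈R
  ...   | a′ , a′∈A , _ , refl with capRule-atoms c∈r
  ...     | inj₁ b+a≡b+a′ = a′ , cong (λ c → capRule c a′) (sym b+a≡b+a′)
  ...     | inj₂ b+a≡a′   = ⊥-elim (m+n≮m b a (subst (_< b) (sym b+a≡a′) (A<b a′∈A)))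

  ↑-agrees : ∀ I {x} → x ∈ atomsOf Q → (I ↑ b) x ≡ I x
  ↑-agrees I x∈Q = ↑-below I (Q<b x∈Q)

  ↑-model : ∀ {I} → IsModel Q I → (∀ {a} → a ∈ A → M a ≤V F* → I a ≤V F*) → IsModel (Q ++ R) (I ↑ b)
  ↑-model {I} modelI low =
    IsModel-++⁺ Q R (IsModel-cong Q (λ x∈ → sym (↑-agrees I x∈)) modelI) capsHold
    where
    capsHold : IsModel R (I ↑ b)
    capsHold r r∈R with ∈-caps⁻ M b A r∈R
    ... | a , a∈A , Ma≤F* , refl = begin
      ⟦ ruleFormula (capRule (b + a) a) ⟧ (I ↑ b)  ≡⟨ ⟦capRule⟧ (b + a) a (I ↑ b) ⟩
      capV ((I ↑ b) (b + a)) ((I ↑ b) a)          ≡⟨ cong₂ capV (↑-shifted I b a) (↑-below I (A<b a∈A)) ⟩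
      capV (I a) (I a)                            ≡⟨ capV-refl (low a∈A Ma≤F*) ⟩
      T                                           ∎

  capped-answerSet⇒answerSet : IsAnswerSet (Q ++ R) (M ↑ b) → IsAnswerSet Q M
  capped-answerSet⇒answerSet (solid , model , minimal) =
      (λ x x∈Q → subst (_≢ T*) (↑-agrees M x∈Q) (solid x (∈-atomsOf-++⁺ˡ Q R x∈Q)))
    , IsModel-cong Q (↑-agrees M) (IsModel-++⁻ˡ Q R model)
    , noneBelow
    where
    -- A model J below M on Q, extended by M outside Q, lifts to a model of Q ++ R below M ↑ b.
    noneBelow : ∀ J → IsModel Q J → ¬ (J ≺[ Q ] M)
    noneBelow J modelJ (J⪯M , x , x∈Q , Jx≢Mx) =
      minimal (J₀ ↑ b) (↑-model modelJ₀ J₀-low)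
        ((λ y _ → J₀⪯M (unshift b y)) , x , ∈-atomsOf-++⁺ˡ Q R x∈Q , differs)
      where
      J₀ : Interpretation
      J₀ = overlay (atomsOf Q) J M
      J₀⪯M : ∀ y → J₀ y ⪯V M y
      J₀⪯M = overlay-⪯ (atomsOf Q) J M J⪯M
      modelJ₀ : IsModel Q J₀
      modelJ₀ = IsModel-cong Q (λ y∈ → sym (overlay-∈ (atomsOf Q) J M y∈)) modelJ
      J₀-low : ∀ {a} → a ∈ A → M a ≤V F* → J₀ a ≤V F*
      J₀-low {a} _ Ma≤F* = ≤-trans (⪯V⇒≤V (J₀⪯M a)) Ma≤F*
      differs : (J₀ ↑ b) x ≢ (M ↑ b) x
      differs eq = Jx≢Mx (begin
        J x        ≡⟨ overlay-∈ (atomsOf Q) J M x∈Q ⟨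
        J₀ x       ≡⟨ ↑-agrees J₀ x∈Q ⟨
        (J₀ ↑ b) x ≡⟨ eq ⟩
        (M ↑ b) x  ≡⟨ ↑-agrees M x∈Q ⟩
        M x        ∎)

  module _ (A⊆Q : A ⊆ atomsOf Q) (Q⊆A : atomsOf Q ⊆ A) (asM : IsAnswerSet Q M) where

    atomCases : ∀ {x} → x ∈ atomsOf (Q ++ R) →
      x ∈ atomsOf Q ⊎ ∃ λ a → a ∈ atomsOf Q × M a ≤V F* × x ≡ b + a
    atomCases x∈ with ∈-atoms⁻ x∈
    ... | inj₁ x∈Q                                = inj₁ x∈Q
    ... | inj₂ (a , a∈A , Ma≤F* , inj₁ x≡b+a)     = inj₂ (a , A⊆Q a∈A , Ma≤F* , x≡b+a)
    ... | inj₂ (a , a∈A , _     , inj₂ refl)      = inj₁ (A⊆Q a∈A)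

    capped-bounds : ∀ {N a} → IsAnswerSet (Q ++ R) N → a ∈ atomsOf Q → M a ≤V F* →
      N a ≤V N (b + a) × N (b + a) ≤V F*
    capped-bounds asN a∈Q Ma≤F* =
      capRule-bounds (Q ++ R) asN (∈-++⁺ʳ Q (∈-caps⁺ M b (Q⊆A a∈Q) Ma≤F*)) (capHead-fresh _)

    capped-solid : Solid (Q ++ R) (M ↑ b)
    capped-solid x x∈ with atomCases x∈
    ... | inj₁ x∈Q                    = subst (_≢ T*) (sym (↑-agrees M x∈Q)) (proj₁ asM x x∈Q)
    ... | inj₂ (a , _ , Ma≤F* , refl) = subst (_≢ T*) (sym (↑-shifted M b a)) (≤F*⇒≢T* Ma≤F*)

    capped-model : IsModel (Q ++ R) (M ↑ b)
    capped-model = ↑-model (proj₁ (proj₂ asM)) (λ _ Ma≤F* → Ma≤F*)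

    capped-minimal : ∀ K → IsModel (Q ++ R) K → ¬ (K ≺[ Q ++ R ] (M ↑ b))
    capped-minimal K modelK (K⪯M↑ , x , x∈ , Kx≢M↑x) = Kx≢M↑x (agrees x∈)
      where
      K⪯M : K ⪯[ Q ] M
      K⪯M y y∈Q = subst (K y ⪯V_) (↑-agrees M y∈Q) (K⪯M↑ y (∈-atomsOf-++⁺ˡ Q R y∈Q))
      agreesOnQ : ∀ {y} → y ∈ atomsOf Q → K y ≡ M y
      agreesOnQ = below-answerSet-agrees Q asM (IsModel-++⁻ˡ Q R modelK) K⪯M
      agrees : ∀ {y} → y ∈ atomsOf (Q ++ R) → K y ≡ (M ↑ b) y
      agrees y∈ with atomCases y∈
      ... | inj₁ y∈Q = trans (agreesOnQ y∈Q) (sym (↑-agrees M y∈Q))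
      ... | inj₂ (a , a∈Q , Ma≤F* , refl) =
        trans (capV-⪯ (subst (K (b + a) ⪯V_) (↑-shifted M b a) (K⪯M↑ (b + a) y∈)) Ma≤F* capHolds)
              (sym (↑-shifted M b a))
        where
        capHolds : capV (K (b + a)) (M a) ≡ T
        capHolds = begin
          capV (K (b + a)) (M a)                    ≡⟨ cong (capV (K (b + a))) (agreesOnQ a∈Q) ⟨
          capV (K (b + a)) (K a)                    ≡⟨ ⟦capRule⟧ (b + a) a K ⟨
          ⟦ ruleFormula (capRule (b + a) a) ⟧ K     ≡⟨ modelK _ (∈-++⁺ʳ Q (∈-caps⁺ M b (Q⊆A a∈Q) Ma≤F*)) ⟩
          T                                         ∎

    capped-preferred : ∀ N → IsAnswerSet (Q ++ R) N → ¬ (N ⊏[ Q ++ R ] (M ↑ b))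
    capped-preferred N asN (N*⊆M↑* , x , x∈ , M↑x≡F* , Nx≢F*) = Nx≢F* (M↑*⊆N* x∈ M↑x≡F*)
      where
      N⪯M : N ⪯[ Q ] M
      N⪯M a a∈Q = solid-⪯V (proj₁ asN a (∈-atomsOf-++⁺ˡ Q R a∈Q)) (proj₁ asM a a∈Q)
        (λ Na≡F* → trans (sym (↑-agrees M a∈Q)) (N*⊆M↑* a (∈-atomsOf-++⁺ˡ Q R a∈Q) Na≡F*))
        (λ Ma≤F* → uncurry ≤-trans (capped-bounds asN a∈Q Ma≤F*))
      agreesOnQ : ∀ {y} → y ∈ atomsOf Q → N y ≡ M y
      agreesOnQ = below-answerSet-agrees Q asM (IsModel-++⁻ˡ Q R (proj₁ (proj₂ asN))) N⪯M
      M↑*⊆N* : ∀ {y} → y ∈ atomsOf (Q ++ R) → (M ↑ b) y ≡ F* → N y ≡ F*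
      M↑*⊆N* y∈ M↑y≡F* with atomCases y∈
      ... | inj₁ y∈Q = trans (agreesOnQ y∈Q) (trans (sym (↑-agrees M y∈Q)) M↑y≡F*)
      ... | inj₂ (a , a∈Q , Ma≤F* , refl) =
        ≤V-antisym Nc≤F* (subst (_≤V N (b + a)) Na≡F* Na≤Nc)
        where
        Na≤Nc : N a ≤V N (b + a)
        Na≤Nc = proj₁ (capped-bounds asN a∈Q Ma≤F*)
        Nc≤F* : N (b + a) ≤V F*
        Nc≤F* = proj₂ (capped-bounds asN a∈Q Ma≤F*)
        Na≡F* : N a ≡ F*
        Na≡F* = trans (agreesOnQ a∈Q) (trans (sym (↑-shifted M b a)) M↑y≡F*)

    capped-mostPreferred : IsMostPreferred (Q ++ R) (M ↑ b)
    capped-mostPreferred = (capped-solid , capped-model , capped-minimal) , capped-preferred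

StronglyIncludedMP : LPOD → LPOD → Set
StronglyIncludedMP P₁ P₂ = ∀ P M → IsMostPreferred (P₁ ++ P) M → IsMostPreferred (P₂ ++ P) M

StronglyIncludedAS : LPOD → LPOD → Set
StronglyIncludedAS P₁ P₂ = ∀ P M → IsAnswerSet (P₁ ++ P) M → IsAnswerSet (P₂ ++ P) M

stronglyIncludedMP⇒AS : ∀ P₁ P₂ → StronglyIncludedMP P₁ P₂ → StronglyIncludedAS P₁ P₂
stronglyIncludedMP⇒AS P₁ P₂ includedMP P M asM = C₂.capped-answerSet⇒answerSet (proj₁ mp₂)
  where
  Q₁ Q₂ : LPOD
  Q₁ = P₁ ++ P
  Q₂ = P₂ ++ P
  b : ℕ
  b = bound (atomsOf Q₁ ++ atomsOf Q₂)
  Q₁<b : ∀ {x} → x ∈ atomsOf Q₁ → x < b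
  Q₁<b x∈ = <-bound (∈-++⁺ˡ x∈)
  Q₂<b : ∀ {x} → x ∈ atomsOf Q₂ → x < b
  Q₂<b x∈ = <-bound (∈-++⁺ʳ (atomsOf Q₁) x∈)
  module C₁ = Capped Q₁ M b (atomsOf Q₁) Q₁<b Q₁<b
  module C₂ = Capped Q₂ M b (atomsOf Q₁) Q₂<b Q₁<b
  R : LPOD
  R = caps M b (atomsOf Q₁)
  mp₁ : IsMostPreferred (P₁ ++ (P ++ R)) (M ↑ b)
  mp₁ = subst (λ X → IsMostPreferred X (M ↑ b)) (++-assoc P₁ P R)
              (C₁.capped-mostPreferred (λ x∈ → x∈) (λ x∈ → x∈) asM)
  mp₂ : IsMostPreferred (Q₂ ++ R) (M ↑ b)
  mp₂ = subst (λ X → IsMostPreferred X (M ↑ b)) (sym (++-assoc P₂ P R))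
              (includedMP (P ++ R) (M ↑ b) mp₁)

corollary1 : (P₁ P₂ : LPOD) →
    (StronglyEquivMP P₁ P₂ → StronglyEquivAS P₁ P₂) ×
    (StronglyEquivAS P₁ P₂ → StronglyEquivMP P₁ P₂)
corollary1 P₁ P₂ = mp⇒as , as⇒mp
  where
  mp⇒as : StronglyEquivMP P₁ P₂ → StronglyEquivAS P₁ P₂
  mp⇒as equivMP P M = stronglyIncludedMP⇒AS P₁ P₂ (λ Q N → proj₁ (equivMP Q N)) P M
                    , stronglyIncludedMP⇒AS P₂ P₁ (λ Q N → proj₂ (equivMP Q N)) P M

  as⇒mp : StronglyEquivAS P₁ P₂ → StronglyEquivMP P₁ P₂
  as⇒mp equivAS P M = mostPreferred-transfer (P₁ ++ P) (P₂ ++ P) to from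
                    , mostPreferred-transfer (P₂ ++ P) (P₁ ++ P) from to
    where
    to : ∀ N → IsAnswerSet (P₁ ++ P) N → IsAnswerSet (P₂ ++ P) N
    to N = proj₁ (equivAS P N)
    from : ∀ N → IsAnswerSet (P₂ ++ P) N → IsAnswerSet (P₁ ++ P) N
    from N = proj₂ (equivAS P N)
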